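{- Let $n,\alpha$ be integers with $1\le\alpha\le n-1$. Then \[f_{\sf TC}(n,\alpha)=\begin{cases} n+1 & \text{if } \alpha=1,\\ 2^{n-1}+1 & \text{if } \alpha=n-1,\\ f_{\sf T}(n-1,\alpha)+f_{\sf T}(n',\alpha') & \text{if } 2\le\alpha\le n-2,\end{cases}\] where $n'=n-\lceil n/\alpha\rceil-\alpha+1$ and $\alpha'=\min(n',\alpha-1)$.
   Context: The Fibonacci index $F(G)$ of a graph is the number of its stable sets, including the empty set. For $1\le\alpha\le n$, the Turán graph $T_{n,\alpha}$ is the disjoint union of $\alpha$ cliques with orders summing to $n$ and pairwise differing by at most one, and $f_{\sf T}(n,\alpha)=F(T_{n,\alpha})$. For $1\le\alpha\le n-1$, the Turán-connected graph $TC_{n,\alpha}$ is obtained from $T_{n,\alpha}$ by choosing a vertex $v$ in a clique of size $\lceil n/\alpha\rceil$ and adding $\alpha-1$ edges joining $v$ to one vertex of each other clique; $f_{\sf TC}(n,\alpha)=F(TC_{n,\alpha})$. -}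

module Defs where

open import Data.Nat using (ℕ; zero; suc; _+_; _∸_; _/_; _%_; _⊓_)
open import Data.Nat.Properties using (_≟_)
open import Data.Bool using (Bool; true; false; _∧_; _∨_; not; if_then_else_)
open import Data.Fin using (Fin; toℕ)
open import Data.Fin.Properties using () renaming (_≟_ to _≟F_)
open import Data.Vec using (Vec; []; _∷_; lookup)
open import Data.List using (List; []; _∷_; map; _++_; filter; length; allFin)
open import Relation.Nullary.Decidable using (⌊_⌋)

record Graph (n : ℕ) : Set where
  field
    adj : Fin n → Fin n → Bool

open Graph public

allL : {A : Set} → (A → Bool) → List A → Bool
allL p [] = true
allL p (x ∷ xs) = p x ∧ allL p xs

subsets : (n : ℕ) → List (Vec Bool n)
subsets zero = [] ∷ []
subsets (suc n) = map (false ∷_) (subsets n) ++ map (true ∷_) (subsets n)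

isStable : ∀ {n} → Graph n → Vec Bool n → Bool
isStable {n} G S =
  allL (λ i → allL (λ j → not (lookup S i ∧ lookup S j ∧ adj G i j)) (allFin n)) (allFin n)

Fib : ∀ {n} → Graph n → ℕ
Fib {n} G = length (filter (λ S → isStable G S Data.Bool.≟ true) (subsets n))

-- Turán graph T_{n,α}: vertex i lies in clique number (i mod α); the α
-- classes have sizes ⌈n/α⌉ or ⌊n/α⌋.  Vertices are adjacent iff they are
-- distinct and lie in the same clique.  (Here α = suc a, i.e. α ≥ 1.)
label : (a : ℕ) → ℕ → ℕ
label a i = i % suc a

turan : (n a : ℕ) → Graph n
turan n a = record { adj = λ i j →
  not ⌊ i ≟F j ⌋ ∧ ⌊ label a (toℕ i) ≟ label a (toℕ j) ⌋ }

-- Turán-connected graph TC_{n,α} (α = suc a): take v = vertex 0, which lies in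
-- clique 0, a clique of maximum size ⌈n/α⌉; vertex c (1 ≤ c ≤ α-1) lies in
-- clique c, and we add the α-1 edges {0, c}, one to each other clique.
extraEdge : (a : ℕ) → ℕ → ℕ → Bool
extraEdge a i j =
  (⌊ i ≟ 0 ⌋ ∧ not ⌊ j ≟ 0 ⌋ ∧ ⌊ j Data.Nat.<? suc a ⌋) ∨
  (⌊ j ≟ 0 ⌋ ∧ not ⌊ i ≟ 0 ⌋ ∧ ⌊ i Data.Nat.<? suc a ⌋)

turanConn : (n a : ℕ) → Graph n
turanConn n a = record { adj = λ i j →
  adj (turan n a) i j ∨ extraEdge a (toℕ i) (toℕ j) }

-- f_T(n, α) and f_TC(n, α), for α ≥ 1 (with α = 0 the value is meaningless;
-- it is never used).
fT : ℕ → ℕ → ℕ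
fT n zero = 0
fT n (suc a) = Fib (turan n a)

fTC : ℕ → ℕ → ℕ
fTC n zero = 0
fTC n (suc a) = Fib (turanConn n a)

ceilDiv : ℕ → ℕ → ℕ
ceilDiv n zero = 0
ceilDiv n (suc a) = (n + a) / suc a

module Submission where

-- Split the stable sets of TC_{n,α} according to whether they contain the hub
-- vertex 0 (the vertex carrying the α-1 extra edges).  Those avoiding the hub
-- are the stable sets of TC - 0, which after the relabelling v ↦ v-1 is the
-- Turán graph T_{n-1,α}.  Those containing the hub are the stable sets of the
-- vertices non-adjacent to it: the α-1 cliques other than the hub's, each
-- without its least vertex.  These again form a Turán graph, T_{n',α'}.

open import Defs
open import Data.Nat using (ℕ; zero; suc; _+_; _*_; _∸_; _^_; _≤_; _<_; _⊓_; _/_; _%_; _≡ᵇ_; _<ᵇ_; _<?_; z≤n; s≤s; NonZero)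
open import Data.Nat.Properties
  using ( _≟_; +-assoc; +-comm; +-identityʳ; +-suc; *-identityˡ; *-identityʳ; *-distribʳ-+; *-distribˡ-+
        ; suc-injective; ≤-refl; ≤-reflexive; ≤-trans; ≤-total; ≤-pred; <⇒≤; n≤1+n; m<n⇒m<1+n; m≤m+n
        ; +-monoˡ-≤; +-cancelˡ-≤; m∸n≤m; m+n∸m≡n; m≤n⇒m⊓n≡m; m≥n⇒m⊓n≡n )
open import Data.Nat.DivMod
  using (m%n<n; m<n⇒m%n≡m; [m+n]%n≡m%n; %-distribˡ-+; m≡m%n+[m/n]*n; m≥n⇒m/n>0; +-distrib-/-∣ˡ; m*n/n≡m; m<n⇒m/n≡0)
open import Data.Nat.Divisibility using (n∣m*n)
open import Data.Nat.Tactic.RingSolver using (solve-∀)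
open import Data.Bool using (Bool; true; false; _∧_; _∨_; not; if_then_else_)
open import Data.Bool.Properties using (∧-zeroʳ; ∧-identityʳ; ∨-identityʳ) renaming (_≟_ to _≟ᴮ_)
open import Data.Fin using (Fin; toℕ) renaming (zero to fzero; suc to fsuc)
open import Data.Fin.Properties using () renaming (_≟_ to _≟F_)
open import Data.Vec using (Vec; []; _∷_; lookup)
open import Data.List using (List; []; _∷_; _++_; map; filter; length; tabulate)
open import Data.List.Properties using (filter-++; length-++)
open import Data.Product using (_×_; _,_; proj₁; proj₂; ∃₂)
open import Data.Sum using (inj₁; inj₂)
open import Data.Empty using (⊥-elim)
open import Function using (_∘_; id)
open import Relation.Nullary using (Dec; yes; no)
open import Relation.Nullary.Decidable using (⌊_⌋; does; isYes≗does)
open import Relation.Binary.PropositionalEquality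
  using (_≡_; _≢_; refl; sym; trans; cong; cong₂; subst₂; module ≡-Reasoning)
open ≡-Reasoning

ind : Bool → ℕ
ind true = 1
ind false = 0

∧-elim : ∀ {x y} → x ∧ y ≡ true → x ≡ true × y ≡ true
∧-elim {true} y≡true = refl , y≡true

∧-intro : ∀ {x y} → x ≡ true → y ≡ true → x ∧ y ≡ true
∧-intro refl y≡true = y≡true

not-elim : ∀ {x} → not x ≡ true → x ≡ false
not-elim {false} _ = refl

Bool-≡ : ∀ {x y} → (x ≡ true → y ≡ true) → (y ≡ true → x ≡ true) → x ≡ y
Bool-≡ {false} {false} _ _ = refl
Bool-≡ {false} {true} _ y⇒x = y⇒x refl
Bool-≡ {true} x⇒y _ = sym (x⇒y refl)

-- The Boolean tests _≡ᵇ_ and _<ᵇ_ compute on successors, unlike the decision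
-- procedures used in Defs; all reasoning below uses them, after converting
-- the adjacency relations of Defs once (fin-≟-≡ᵇ, turan-labels, extraEdge-hub).
≡ᵇ-refl : ∀ n → (n ≡ᵇ n) ≡ true
≡ᵇ-refl zero = refl
≡ᵇ-refl (suc n) = ≡ᵇ-refl n

≡ᵇ-false : ∀ {m n} → m ≢ n → (m ≡ᵇ n) ≡ false
≡ᵇ-false {zero} {zero} m≢n = ⊥-elim (m≢n refl)
≡ᵇ-false {zero} {suc n} _ = refl
≡ᵇ-false {suc m} {zero} _ = refl
≡ᵇ-false {suc m} {suc n} m≢n = ≡ᵇ-false (m≢n ∘ cong suc)

≡ᵇ-true : ∀ {m n} → m ≡ n → (m ≡ᵇ n) ≡ true
≡ᵇ-true {m} refl = ≡ᵇ-refl m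

≡ᵇ-cong : ∀ {m n m′ n′} → (m ≡ n → m′ ≡ n′) → (m′ ≡ n′ → m ≡ n) → (m ≡ᵇ n) ≡ (m′ ≡ᵇ n′)
≡ᵇ-cong {m} {n} to from with m ≟ n
... | yes m≡n = trans (≡ᵇ-true m≡n) (sym (≡ᵇ-true (to m≡n)))
... | no m≢n = trans (≡ᵇ-false m≢n) (sym (≡ᵇ-false (m≢n ∘ from)))

<ᵇ-true : ∀ {m n} → m < n → (m <ᵇ n) ≡ true
<ᵇ-true {zero} {suc n} _ = refl
<ᵇ-true {suc m} {suc n} (s≤s m<n) = <ᵇ-true m<n

<ᵇ-false : ∀ {m n} → n ≤ m → (m <ᵇ n) ≡ false
<ᵇ-false {m} {zero} _ = refl
<ᵇ-false {suc m} {suc n} (s≤s n≤m) = <ᵇ-false n≤m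

<ᵇ-pred : ∀ c r → (suc c <ᵇ r) ≡ (c <ᵇ r ∸ 1)
<ᵇ-pred c zero = refl
<ᵇ-pred c (suc r) = refl

fin-≟-≡ᵇ : ∀ {n} (i j : Fin n) → ⌊ i ≟F j ⌋ ≡ (toℕ i ≡ᵇ toℕ j)
fin-≟-≡ᵇ i j = trans (isYes≗does (i ≟F j)) (decision i j)
  where
  decision : ∀ {n} (i j : Fin n) → does (i ≟F j) ≡ (toℕ i ≡ᵇ toℕ j)
  decision fzero fzero = refl
  decision fzero (fsuc j) = refl
  decision (fsuc i) fzero = refl
  decision (fsuc i) (fsuc j) = decision i j

count : ∀ {n} → (Vec Bool n → Bool) → ℕ
count {zero} p = ind (p [])
count {suc n} p = count (λ S → p (false ∷ S)) + count (λ S → p (true ∷ S))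

count-cong : ∀ {n} {p q : Vec Bool n → Bool} → (∀ S → p S ≡ q S) → count p ≡ count q
count-cong {zero} p≗q = cong ind (p≗q [])
count-cong {suc n} p≗q = cong₂ _+_ (count-cong (p≗q ∘ (false ∷_))) (count-cong (p≗q ∘ (true ∷_)))

count-none : ∀ {n} → count {n} (λ _ → false) ≡ 0
count-none {zero} = refl
count-none {suc n} = cong₂ _+_ (count-none {n}) (count-none {n})

count-∧ : ∀ {n} b (p : Vec Bool n → Bool) → count (λ S → b ∧ p S) ≡ (if b then count p else 0)
count-∧ true p = refl
count-∧ {n} false p = count-none {n}

length-filter-map : ∀ {A B : Set} (p : B → Bool) (f : A → B) (xs : List A) →
  length (filter (λ y → p y ≟ᴮ true) (map f xs)) ≡ length (filter (λ x → p (f x) ≟ᴮ true) xs)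
length-filter-map p f [] = refl
length-filter-map p f (x ∷ xs) with p (f x)
... | true = cong suc (length-filter-map p f xs)
... | false = length-filter-map p f xs

count-subsets : ∀ n (p : Vec Bool n → Bool) →
  length (filter (λ S → p S ≟ᴮ true) (subsets n)) ≡ count p
count-subsets zero p with p []
... | true = refl
... | false = refl
count-subsets (suc n) p = begin
    length (filter accept (map (false ∷_) (subsets n) ++ map (true ∷_) (subsets n)))
  ≡⟨ cong length (filter-++ accept (map (false ∷_) (subsets n)) _) ⟩
    length (filter accept (map (false ∷_) (subsets n)) ++ filter accept (map (true ∷_) (subsets n)))
  ≡⟨ length-++ (filter accept (map (false ∷_) (subsets n))) ⟩
    length (filter accept (map (false ∷_) (subsets n))) + length (filter accept (map (true ∷_) (subsets n)))
  ≡⟨ cong₂ _+_ (half false) (half true) ⟩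
    count p
  ∎
  where
  accept : ∀ S → Dec (p S ≡ true)
  accept = λ S → p S ≟ᴮ true
  half : ∀ b → length (filter accept (map (b ∷_) (subsets n))) ≡ count (λ S → p (b ∷ S))
  half b = trans (length-filter-map p (b ∷_) (subsets n)) (count-subsets n (λ S → p (b ∷ S)))

Fib-count : ∀ {n} (G : Graph n) → Fib G ≡ count (isStable G)
Fib-count {n} G = count-subsets n (isStable G)

-- Graphs whose vertices are labelled by natural numbers, and masks of the
-- vertices that may still be chosen.
Adj : Set
Adj = ℕ → ℕ → Bool

Mask : Set
Mask = ℕ → Bool

unrestricted : Mask
unrestricted _ = true

up : Adj → Adj
up A v w = A (suc v) (suc w)

nonAdjacent : Adj → ℕ → ℕ → Bool
nonAdjacent A v w = not (A v w) ∧ not (A w v)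

avoid : Adj → Mask → Mask
avoid A P w = P (suc w) ∧ nonAdjacent A 0 (suc w)

stable? : ∀ {k} → Adj → Mask → Vec Bool k → Bool
stable? A P [] = true
stable? A P (false ∷ S) = stable? (up A) (P ∘ suc) S
stable? A P (true ∷ S) = (not (A 0 0) ∧ P 0) ∧ stable? (up A) (avoid A P) S

-- The intended meaning of stable?, used to compare it with isStable.
Stable : ∀ {k} → Adj → Vec Bool k → Set
Stable A S = ∀ i j → lookup S i ≡ true → lookup S j ≡ true → A (toℕ i) (toℕ j) ≡ false

Admissible : ∀ {k} → Mask → Vec Bool k → Set
Admissible P S = ∀ i → lookup S i ≡ true → P (toℕ i) ≡ true

stable?-sound : ∀ {k} A P (S : Vec Bool k) → stable? A P S ≡ true → Stable A S × Admissible P S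
stable?-sound A P [] _ = (λ ()) , (λ ())
stable?-sound A P (false ∷ S) ok with stable?-sound (up A) (P ∘ suc) S ok
... | stab , adm =
  (λ { fzero _ () _ ; (fsuc i) fzero _ () ; (fsuc i) (fsuc j) → stab i j }) ,
  (λ { fzero () ; (fsuc i) → adm i })
stable?-sound A P (true ∷ S) ok with ∧-elim ok
... | first , rest with ∧-elim first | stable?-sound (up A) (avoid A P) S rest
... | loop-free , P0 | stab , adm = stab′ , adm′
  where
  later : ∀ j → lookup S j ≡ true →
    P (suc (toℕ j)) ≡ true × A 0 (suc (toℕ j)) ≡ false × A (suc (toℕ j)) 0 ≡ false
  later j Sj with ∧-elim (adm j Sj)
  ... | Pj , non-adjacent with ∧-elim non-adjacent
  ... | no-edge , no-edge′ = Pj , not-elim no-edge , not-elim no-edge′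
  stab′ : Stable A (true ∷ S)
  stab′ fzero fzero _ _ = not-elim loop-free
  stab′ fzero (fsuc j) _ Sj = proj₁ (proj₂ (later j Sj))
  stab′ (fsuc i) fzero Si _ = proj₂ (proj₂ (later i Si))
  stab′ (fsuc i) (fsuc j) Si Sj = stab i j Si Sj
  adm′ : Admissible P (true ∷ S)
  adm′ fzero _ = P0
  adm′ (fsuc i) Si = proj₁ (later i Si)

stable?-complete : ∀ {k} A P (S : Vec Bool k) → Stable A S → Admissible P S → stable? A P S ≡ true
stable?-complete A P [] _ _ = refl
stable?-complete A P (false ∷ S) stab adm =
  stable?-complete (up A) (P ∘ suc) S (λ i j → stab (fsuc i) (fsuc j)) (adm ∘ fsuc)
stable?-complete A P (true ∷ S) stab adm =
  ∧-intro (∧-intro (cong not (stab fzero fzero refl refl)) (adm fzero refl))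
    (stable?-complete (up A) (avoid A P) S (λ i j → stab (fsuc i) (fsuc j)) later)
  where
  later : Admissible (avoid A P) S
  later i Si = ∧-intro (adm (fsuc i) Si)
    (∧-intro (cong not (stab fzero (fsuc i) refl Si)) (cong not (stab (fsuc i) fzero Si refl)))

stable?-cong : ∀ {k} {A B : Adj} {P Q : Mask} → (∀ v w → A v w ≡ B v w) → (∀ v → P v ≡ Q v) →
  (S : Vec Bool k) → stable? A P S ≡ stable? B Q S
stable?-cong A≗B P≗Q [] = refl
stable?-cong A≗B P≗Q (false ∷ S) = stable?-cong (λ v w → A≗B (suc v) (suc w)) (P≗Q ∘ suc) S
stable?-cong {A = A} {B} {P} {Q} A≗B P≗Q (true ∷ S) =
  cong₂ _∧_ (cong₂ (λ x y → not x ∧ y) (A≗B 0 0) (P≗Q 0))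
    (stable?-cong (λ v w → A≗B (suc v) (suc w)) avoid≗ S)
  where
  avoid≗ : ∀ w → avoid A P w ≡ avoid B Q w
  avoid≗ w = cong₂ _∧_ (P≗Q (suc w)) (cong₂ (λ x y → not x ∧ not y) (A≗B 0 (suc w)) (A≗B (suc w) 0))

stableCount : Adj → Mask → ℕ → ℕ
stableCount A P k = count {k} (stable? A P)

-- Either vertex 0 is left out, or it is chosen and its neighbours are excluded.
stableCount-suc : ∀ A P k → stableCount A P (suc k) ≡
  stableCount (up A) (P ∘ suc) k + (if not (A 0 0) ∧ P 0 then stableCount (up A) (avoid A P) k else 0)
stableCount-suc A P k =
  cong (stableCount (up A) (P ∘ suc) k +_) (count-∧ {k} (not (A 0 0) ∧ P 0) (stable? (up A) (avoid A P)))

stableCount-cong : ∀ {A B : Adj} {P Q : Mask} k → (∀ v w → A v w ≡ B v w) → (∀ v → P v ≡ Q v) →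
  stableCount A P k ≡ stableCount B Q k
stableCount-cong k A≗B P≗Q = count-cong {k} (stable?-cong A≗B P≗Q)

Labels : ∀ {n} → Graph n → Adj → Set
Labels G A = ∀ i j → adj G i j ≡ A (toℕ i) (toℕ j)

allL-elim : ∀ {X : Set} {n} (p : X → Bool) (f : Fin n → X) → allL p (tabulate f) ≡ true → ∀ i → p (f i) ≡ true
allL-elim p f ok fzero = proj₁ (∧-elim ok)
allL-elim p f ok (fsuc i) = allL-elim p (f ∘ fsuc) (proj₂ (∧-elim ok)) i

allL-intro : ∀ {X : Set} {n} (p : X → Bool) (f : Fin n → X) → (∀ i → p (f i) ≡ true) → allL p (tabulate f) ≡ true
allL-intro {n = zero} p f _ = refl
allL-intro {n = suc n} p f ok = ∧-intro (ok fzero) (allL-intro p (f ∘ fsuc) (ok ∘ fsuc))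

isStable⇒Stable : ∀ {n} (G : Graph n) A → Labels G A → ∀ S → isStable G S ≡ true → Stable A S
isStable⇒Stable G A labels S ok i j Si Sj = trans (sym (labels i j)) (not-elim pair-ok)
  where
  pair-ok : not (adj G i j) ≡ true
  pair-ok = subst₂ (λ x y → not (x ∧ y ∧ adj G i j) ≡ true) Si Sj
    (allL-elim _ id (allL-elim _ id ok i) j)

Stable⇒isStable : ∀ {n} (G : Graph n) A → Labels G A → ∀ S → Stable A S → isStable G S ≡ true
Stable⇒isStable G A labels S stab = allL-intro _ id (λ i → allL-intro _ id (pair-ok i))
  where
  pair-ok : ∀ i j → not (lookup S i ∧ lookup S j ∧ adj G i j) ≡ true
  pair-ok i j with lookup S i in Si | lookup S j in Sj
  ... | false | _ = refl
  ... | true | false = refl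
  ... | true | true = cong not (trans (labels i j) (stab i j Si Sj))

Fib-stableCount : ∀ {n} (G : Graph n) A → Labels G A → Fib G ≡ stableCount A unrestricted n
Fib-stableCount G A labels = trans (Fib-count G) (count-cong λ S → Bool-≡
  (λ ok → stable?-complete A unrestricted S (isStable⇒Stable G A labels S ok) (λ _ _ → refl))
  (λ ok → Stable⇒isStable G A labels S (proj₁ (stable?-sound A unrestricted S ok))))

countWhere : Mask → ℕ → ℕ
countWhere Q zero = 0
countWhere Q (suc k) = ind (Q 0) + countWhere (Q ∘ suc) k

countWhere-cong : ∀ {Q Q′ : Mask} k → (∀ v → v < k → Q v ≡ Q′ v) → countWhere Q k ≡ countWhere Q′ k
countWhere-cong zero _ = refl
countWhere-cong (suc k) Q≗Q′ =
  cong₂ _+_ (cong ind (Q≗Q′ 0 (s≤s z≤n))) (countWhere-cong k (λ v v<k → Q≗Q′ (suc v) (s≤s v<k)))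

countWhere-none : ∀ k → countWhere (λ _ → false) k ≡ 0
countWhere-none zero = refl
countWhere-none (suc k) = countWhere-none k

countWhere-+ : ∀ (Q : Mask) k l → countWhere Q (k + l) ≡ countWhere Q k + countWhere (λ v → Q (k + v)) l
countWhere-+ Q zero l = refl
countWhere-+ Q (suc k) l =
  trans (cong (ind (Q 0) +_) (countWhere-+ (Q ∘ suc) k l)) (sym (+-assoc (ind (Q 0)) _ _))

countWhere-point : ∀ c r → countWhere (λ v → v ≡ᵇ c) r ≡ ind (c <ᵇ r)
countWhere-point c zero = refl
countWhere-point zero (suc r) = cong suc (countWhere-none r)
countWhere-point (suc c) (suc r) = countWhere-point c r

prod : ℕ → (ℕ → ℕ) → ℕ
prod zero f = 1
prod (suc m) f = f 0 * prod m (f ∘ suc)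

prod-cong : ∀ m {f g : ℕ → ℕ} → (∀ c → c < m → f c ≡ g c) → prod m f ≡ prod m g
prod-cong zero _ = refl
prod-cong (suc m) f≗g = cong₂ _*_ (f≗g 0 (s≤s z≤n)) (prod-cong m (λ c c<m → f≗g (suc c) (s≤s c<m)))

prod-ones : ∀ m → prod m (λ _ → 1) ≡ 1
prod-ones zero = refl
prod-ones (suc m) = trans (+-identityʳ _) (prod-ones m)

prod-add-at : ∀ m {f g h : ℕ → ℕ} ℓ → ℓ < m →
  (∀ c → c ≢ ℓ → f c ≡ h c) → (∀ c → c ≢ ℓ → g c ≡ h c) → f ℓ + g ℓ ≡ h ℓ →
  prod m f + prod m g ≡ prod m h
prod-add-at (suc m) {f} {g} {h} zero _ f≗h g≗h at-ℓ = begin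
    f 0 * prod m (f ∘ suc) + g 0 * prod m (g ∘ suc)
  ≡⟨ cong₂ (λ x y → f 0 * x + g 0 * y) (rest f≗h) (rest g≗h) ⟩
    f 0 * H + g 0 * H
  ≡⟨ sym (*-distribʳ-+ H (f 0) (g 0)) ⟩
    (f 0 + g 0) * H
  ≡⟨ cong (_* H) at-ℓ ⟩
    h 0 * H
  ∎
  where
  H : ℕ
  H = prod m (h ∘ suc)
  rest : ∀ {k : ℕ → ℕ} → (∀ c → c ≢ 0 → k c ≡ h c) → prod m (k ∘ suc) ≡ H
  rest k≗h = prod-cong m (λ c _ → k≗h (suc c) (λ ()))
prod-add-at (suc m) {f} {g} {h} (suc ℓ) (s≤s ℓ<m) f≗h g≗h at-ℓ = begin
    f 0 * prod m (f ∘ suc) + g 0 * prod m (g ∘ suc)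
  ≡⟨ cong₂ (λ x y → x * prod m (f ∘ suc) + y * prod m (g ∘ suc)) (f≗h 0 (λ ())) (g≗h 0 (λ ())) ⟩
    h 0 * prod m (f ∘ suc) + h 0 * prod m (g ∘ suc)
  ≡⟨ sym (*-distribˡ-+ (h 0) _ _) ⟩
    h 0 * (prod m (f ∘ suc) + prod m (g ∘ suc))
  ≡⟨ cong (h 0 *_) (prod-add-at m ℓ ℓ<m (λ c c≢ℓ → f≗h (suc c) (c≢ℓ ∘ suc-injective))
                                       (λ c c≢ℓ → g≗h (suc c) (c≢ℓ ∘ suc-injective)) at-ℓ) ⟩
    h 0 * prod m (h ∘ suc)
  ∎

cliques : (ℕ → ℕ) → Adj
cliques κ v w = not (v ≡ᵇ w) ∧ (κ v ≡ᵇ κ w)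

classSize : (ℕ → ℕ) → Mask → ℕ → ℕ → ℕ
classSize κ P c k = countWhere (λ v → P v ∧ (κ v ≡ᵇ c)) k

-- A stable set of a disjoint union of cliques picks at most one vertex per
-- clique, independently: the count is Π_c (1 + |allowed vertices of class c|).
cliqueProduct : ∀ {α} (κ : ℕ → ℕ) → (∀ v → κ v < α) → ∀ P k →
  stableCount (cliques κ) P k ≡ prod α (λ c → suc (classSize κ P c k))
cliqueProduct {α} κ κ<α P zero = sym (prod-ones α)
cliqueProduct {α} κ κ<α P (suc k) = begin
    stableCount (cliques κ) P (suc k)
  ≡⟨ stableCount-suc (cliques κ) P k ⟩
    stableCount (cliques κ′) (P ∘ suc) k + (if P 0 then stableCount (cliques κ′) P′ k else 0)
  ≡⟨ cong₂ (λ x y → x + (if P 0 then y else 0))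
       (cliqueProduct κ′ (κ<α ∘ suc) (P ∘ suc) k) (cliqueProduct κ′ (κ<α ∘ suc) P′ k) ⟩
    prod α (λ c → suc (N c)) + (if P 0 then prod α (λ c → suc (N′ c)) else 0)
  ≡⟨ add-vertex-0 (P 0) ⟩
    prod α (λ c → suc (classSize κ P c (suc k)))
  ∎
  where
  κ′ : ℕ → ℕ
  κ′ = κ ∘ suc
  ℓ : ℕ
  ℓ = κ 0
  P′ : Mask
  P′ = avoid (cliques κ) P
  N N′ : ℕ → ℕ
  N c = classSize κ′ (P ∘ suc) c k
  N′ c = classSize κ′ P′ c k

  other-class : ∀ c → c ≢ ℓ → N′ c ≡ N c
  other-class c c≢ℓ = countWhere-cong k (λ v _ → same-mask v)
    where
    same-mask : ∀ v → P′ v ∧ (κ′ v ≡ᵇ c) ≡ P (suc v) ∧ (κ′ v ≡ᵇ c)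
    same-mask v with κ′ v ≟ c
    ... | yes refl rewrite ≡ᵇ-false c≢ℓ | ≡ᵇ-false (c≢ℓ ∘ sym) | ≡ᵇ-refl (κ′ v) = ∧-identityʳ _
    ... | no v∉c rewrite ≡ᵇ-false v∉c = trans (∧-zeroʳ _) (sym (∧-zeroʳ _))

  own-class : N′ ℓ ≡ 0
  own-class = trans (countWhere-cong k (λ v _ → excluded v)) (countWhere-none k)
    where
    excluded : ∀ v → P′ v ∧ (κ′ v ≡ᵇ ℓ) ≡ false
    excluded v with κ′ v ≟ ℓ
    ... | yes v∈ℓ rewrite v∈ℓ | ≡ᵇ-refl ℓ = trans (∧-identityʳ _) (∧-zeroʳ _)
    ... | no v∉ℓ rewrite ≡ᵇ-false v∉ℓ = ∧-zeroʳ _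

  add-vertex-0 : ∀ b → prod α (λ c → suc (N c)) + (if b then prod α (λ c → suc (N′ c)) else 0)
                     ≡ prod α (λ c → suc (ind (b ∧ (ℓ ≡ᵇ c)) + N c))
  add-vertex-0 false = +-identityʳ _
  add-vertex-0 true = prod-add-at α ℓ (κ<α 0) unchanged (λ c c≢ℓ → trans (cong suc (other-class c c≢ℓ)) (unchanged c c≢ℓ)) grown
    where
    unchanged : ∀ c → c ≢ ℓ → suc (N c) ≡ suc (ind (ℓ ≡ᵇ c) + N c)
    unchanged c c≢ℓ = cong (λ b → suc (ind b + N c)) (sym (≡ᵇ-false (c≢ℓ ∘ sym)))
    grown : suc (N ℓ) + suc (N′ ℓ) ≡ suc (ind (ℓ ≡ᵇ ℓ) + N ℓ)
    grown = begin
        suc (N ℓ) + suc (N′ ℓ)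
      ≡⟨ cong (λ x → suc (N ℓ) + suc x) own-class ⟩
        suc (N ℓ) + 1
      ≡⟨ +-comm (suc (N ℓ)) 1 ⟩
        suc (suc (N ℓ))
      ≡⟨ cong (λ b → suc (ind b + N ℓ)) (sym (≡ᵇ-refl ℓ)) ⟩
        suc (ind (ℓ ≡ᵇ ℓ) + N ℓ)
      ∎

mod-+-cong : ∀ d .{{_ : NonZero d}} k {x y} → x % d ≡ y % d → (k + x) % d ≡ (k + y) % d
mod-+-cong d k {x} {y} x≡y = begin
    (k + x) % d            ≡⟨ %-distribˡ-+ k x d ⟩
    (k % d + x % d) % d    ≡⟨ cong (λ z → (k % d + z) % d) x≡y ⟩
    (k % d + y % d) % d    ≡⟨ %-distribˡ-+ k y d ⟨
    (k + y) % d            ∎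

mod-period : ∀ d .{{_ : NonZero d}} v → (d + v) % d ≡ v % d
mod-period d v = trans (cong (_% d) (+-comm d v)) ([m+n]%n≡m%n v d)

mod-suc-≡ᵇ : ∀ a v w → (suc v % suc a ≡ᵇ suc w % suc a) ≡ (v % suc a ≡ᵇ w % suc a)
mod-suc-≡ᵇ a v w = ≡ᵇ-cong cancel (mod-+-cong α 1)
  where
  α : ℕ
  α = suc a
  back : ∀ u → u % α ≡ (a + suc u) % α
  back u = trans (sym (mod-period α u)) (cong (_% α) (sym (+-suc a u)))
  cancel : suc v % α ≡ suc w % α → v % α ≡ w % α
  cancel e = trans (back v) (trans (mod-+-cong α a e) (sym (back w)))

residueCount : ∀ a q r c → c < suc a → r ≤ suc a →
  countWhere (λ v → v % suc a ≡ᵇ c) (q * suc a + r) ≡ q + ind (c <ᵇ r)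
residueCount a zero r c _ r≤α =
  trans (countWhere-cong r (λ v v<r → cong (_≡ᵇ c) (m<n⇒m%n≡m (≤-trans v<r r≤α))))
        (countWhere-point c r)
residueCount a (suc q) r c c<α r≤α = begin
    countWhere Q ((α + q * α) + r)
  ≡⟨ cong (countWhere Q) (+-assoc α (q * α) r) ⟩
    countWhere Q (α + (q * α + r))
  ≡⟨ countWhere-+ Q α (q * α + r) ⟩
    countWhere Q α + countWhere (λ v → Q (α + v)) (q * α + r)
  ≡⟨ cong₂ _+_ (residueCount a 0 α c c<α ≤-refl)
               (countWhere-cong (q * α + r) (λ v _ → cong (_≡ᵇ c) (mod-period α v))) ⟩
    ind (c <ᵇ α) + countWhere Q (q * α + r)
  ≡⟨ cong₂ _+_ (cong ind (<ᵇ-true c<α)) (residueCount a q r c c<α r≤α) ⟩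
    suc (q + ind (c <ᵇ r))
  ∎
  where
  α : ℕ
  α = suc a
  Q : Mask
  Q v = v % α ≡ᵇ c

-- Fibonacci index of the disjoint union of α cliques, r of order q+1 and
-- α-r of order q, i.e. of T_{qα+r, α}.
turanIndex : ℕ → ℕ → ℕ → ℕ
turanIndex α q r = prod α (λ c → suc (q + ind (c <ᵇ r)))

-- With q = 0 the graph is edgeless on s vertices.
turanIndex-edgeless : ∀ {m s} → s ≤ m → turanIndex m 0 s ≡ 2 ^ s
turanIndex-edgeless {zero} {zero} _ = refl
turanIndex-edgeless {suc m} {zero} _ = trans (+-identityʳ _) (turanIndex-edgeless {m} z≤n)
turanIndex-edgeless {suc m} {suc s} (s≤s s≤m) = cong (2 *_) (turanIndex-edgeless s≤m)

turan-labels : ∀ n a → Labels (turan n a) (cliques (_% suc a))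
turan-labels n a i j =
  cong₂ (λ x y → not x ∧ y) (fin-≟-≡ᵇ i j) (isYes≗does (toℕ i % suc a ≟ toℕ j % suc a))

fT-stableCount : ∀ n a → fT n (suc a) ≡ stableCount (cliques (_% suc a)) unrestricted n
fT-stableCount n a = Fib-stableCount (turan n a) _ (turan-labels n a)

fT-turanIndex : ∀ a q r → r ≤ suc a → fT (q * suc a + r) (suc a) ≡ turanIndex (suc a) q r
fT-turanIndex a q r r≤α = begin
    fT N α
  ≡⟨ fT-stableCount N a ⟩
    stableCount (cliques (_% α)) unrestricted N
  ≡⟨ cliqueProduct (_% α) (λ v → m%n<n v α) unrestricted N ⟩
    prod α (λ c → suc (classSize (_% α) unrestricted c N))
  ≡⟨ prod-cong α (λ c c<α → cong suc (residueCount a q r c c<α r≤α)) ⟩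
    turanIndex α q r
  ∎
  where
  α : ℕ
  α = suc a
  N : ℕ
  N = q * α + r

fT-edgeless : ∀ {N a} → N ≤ suc a → fT N (suc a) ≡ 2 ^ N
fT-edgeless {N} {a} N≤α = trans (fT-turanIndex a 0 N N≤α) (turanIndex-edgeless N≤α)

fT-min : ∀ N a → 1 ≤ N → fT N (suc a) ≡ fT N (N ⊓ suc a)
fT-min (suc k) a _ with ≤-total (suc k) (suc a)
... | inj₁ N≤α = begin
    fT (suc k) (suc a)              ≡⟨ fT-edgeless N≤α ⟩
    2 ^ suc k                       ≡⟨ fT-edgeless {a = k} ≤-refl ⟨
    fT (suc k) (suc k)              ≡⟨ cong (fT (suc k)) (m≤n⇒m⊓n≡m N≤α) ⟨
    fT (suc k) (suc k ⊓ suc a)      ∎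
... | inj₂ α≤N = cong (fT (suc k)) (sym (m≥n⇒m⊓n≡n α≤N))

-- T_{m,1} is the complete graph K_m.
fT-complete : ∀ m → fT m 1 ≡ suc m
fT-complete m = begin
    fT m 1
  ≡⟨ cong (λ N → fT N 1) m≡ ⟩
    fT (m * 1 + 0) 1
  ≡⟨ fT-turanIndex 0 m 0 z≤n ⟩
    suc (m + 0) * 1
  ≡⟨ *-identityʳ _ ⟩
    suc (m + 0)
  ≡⟨ cong suc (+-identityʳ m) ⟩
    suc m
  ∎
  where
  m≡ : m ≡ m * 1 + 0
  m≡ = sym (trans (+-identityʳ (m * 1)) (*-identityʳ m))

hub : ℕ → Adj
hub α v w = ((v ≡ᵇ 0) ∧ not (w ≡ᵇ 0) ∧ (w <ᵇ α)) ∨ ((w ≡ᵇ 0) ∧ not (v ≡ᵇ 0) ∧ (v <ᵇ α))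

-- TC_{n,α} for α = a + 1; the hub 0 lies in residue class 0, of maximum size.
turanConnAdj : ℕ → Adj
turanConnAdj a v w = cliques (_% suc a) v w ∨ hub (suc a) v w

extraEdge-hub : ∀ a v w → extraEdge a v w ≡ hub (suc a) v w
extraEdge-hub a v w
  rewrite isYes≗does (v ≟ 0) | isYes≗does (w ≟ 0) | isYes≗does (v <? suc a) | isYes≗does (w <? suc a) = refl

fTC-stableCount : ∀ n a → fTC n (suc a) ≡ stableCount (turanConnAdj a) unrestricted n
fTC-stableCount n a = Fib-stableCount (turanConn n a) _
  (λ i j → cong₂ _∨_ (turan-labels n a i j) (extraEdge-hub a (toℕ i) (toℕ j)))

hub-nonAdjacent : ∀ a u →
  nonAdjacent (turanConnAdj a) 0 (suc u) ≡ not (suc u <ᵇ suc a) ∧ not (suc u % suc a ≡ᵇ 0)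
hub-nonAdjacent a u = truth-table (suc u % suc a) (u <ᵇ a)
  where
  truth-table : ∀ x b → not ((0 ≡ᵇ x) ∨ (b ∨ false)) ∧ not ((x ≡ᵇ 0) ∨ (false ∨ b)) ≡ not b ∧ not (x ≡ᵇ 0)
  truth-table zero false = refl
  truth-table zero true = refl
  truth-table (suc x) false = refl
  truth-table (suc x) true = refl

clash : ∀ x y → (x ∧ not y) ∧ y ≡ false
clash false _ = refl
clash true false = refl
clash true true = refl

nonzero-class : ∀ x c → not (x ≡ᵇ 0) ∧ (x ≡ᵇ suc c) ≡ (x ≡ᵇ suc c)
nonzero-class zero c = refl
nonzero-class (suc x) c = refl

without-hub : ∀ m a → stableCount (up (turanConnAdj a)) unrestricted m ≡ fT m (suc a)
without-hub m a = trans (stableCount-cong m relabel (λ _ → refl)) (sym (fT-stableCount m a))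
  where
  relabel : ∀ v w → up (turanConnAdj a) v w ≡ cliques (_% suc a) v w
  relabel v w = trans (∨-identityʳ _) (cong (λ x → not (v ≡ᵇ w) ∧ x) (mod-suc-≡ᵇ a v w))

-- Choosing the hub leaves the vertices u ≥ α with u ≢ 0 (mod α): α-1 cliques,
-- the c-th of order q + [c < r-1] when n = (q+1)α + r.
with-hub : ∀ m a q r → r < suc a → m ≡ a + (q * suc a + r) →
  stableCount (up (turanConnAdj a)) (avoid (turanConnAdj a) unrestricted) m ≡ turanIndex a q (r ∸ 1)
with-hub m a q r r<α m≡ = begin
    stableCount (up (turanConnAdj a)) far m
  ≡⟨ stableCount-cong m (λ v w → ∨-identityʳ _) (λ _ → refl) ⟩
    stableCount (cliques κ) far m
  ≡⟨ cliqueProduct κ (λ v → m%n<n (suc v) α) far m ⟩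
    suc (classSize κ far 0 m) * prod a (λ c → suc (classSize κ far (suc c) m))
  ≡⟨ cong₂ _*_ (cong suc hub-clique) (prod-cong a (λ c c<a → cong suc (other-clique c c<a))) ⟩
    1 * turanIndex a q (r ∸ 1)
  ≡⟨ *-identityˡ _ ⟩
    turanIndex a q (r ∸ 1)
  ∎
  where
  α : ℕ
  α = suc a
  far : Mask
  far = avoid (turanConnAdj a) unrestricted
  κ : ℕ → ℕ
  κ v = suc v % α

  -- the rest of the hub's clique is adjacent to the hub
  hub-clique : classSize κ far 0 m ≡ 0
  hub-clique = trans (countWhere-cong m (λ v _ → in-hub-clique v)) (countWhere-none m)
    where
    in-hub-clique : ∀ v → far v ∧ (κ v ≡ᵇ 0) ≡ false
    in-hub-clique v = trans (cong (_∧ (κ v ≡ᵇ 0)) (hub-nonAdjacent a v)) (clash (not (v <ᵇ a)) (κ v ≡ᵇ 0))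

  other-clique : ∀ c → c < a → classSize κ far (suc c) m ≡ q + ind (c <ᵇ r ∸ 1)
  other-clique c c<a = begin
      countWhere Q m
    ≡⟨ cong (countWhere Q) m≡ ⟩
      countWhere Q (a + (q * α + r))
    ≡⟨ countWhere-+ Q a (q * α + r) ⟩
      countWhere Q a + countWhere (λ v → Q (a + v)) (q * α + r)
    ≡⟨ cong₂ _+_ hub-neighbours (countWhere-cong (q * α + r) (λ v _ → beyond v)) ⟩
      countWhere (λ v → v % α ≡ᵇ suc c) (q * α + r)
    ≡⟨ residueCount a q r (suc c) (s≤s c<a) (<⇒≤ r<α) ⟩
      q + ind (suc c <ᵇ r)
    ≡⟨ cong (λ b → q + ind b) (<ᵇ-pred c r) ⟩
      q + ind (c <ᵇ r ∸ 1)
    ∎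
    where
    Q : Mask
    Q v = far v ∧ (κ v ≡ᵇ suc c)
    -- the vertices 1, …, α-1 are the hub's extra neighbours
    hub-neighbours : countWhere Q a ≡ 0
    hub-neighbours = trans (countWhere-cong a neighbour) (countWhere-none a)
      where
      neighbour : ∀ v → v < a → Q v ≡ false
      neighbour v v<a = trans (cong (_∧ (κ v ≡ᵇ suc c)) (hub-nonAdjacent a v))
        (cong (λ b → (not b ∧ not (κ v ≡ᵇ 0)) ∧ (κ v ≡ᵇ suc c)) (<ᵇ-true v<a))
    -- a vertex α + v is far from the hub iff it is not in the hub's clique
    beyond : ∀ v → Q (a + v) ≡ (v % α ≡ᵇ suc c)
    beyond v = begin
        Q (a + v)
      ≡⟨ cong (_∧ (κ (a + v) ≡ᵇ suc c)) (hub-nonAdjacent a (a + v)) ⟩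
        (not (a + v <ᵇ a) ∧ not (κ (a + v) ≡ᵇ 0)) ∧ (κ (a + v) ≡ᵇ suc c)
      ≡⟨ cong (λ b → (not b ∧ not (κ (a + v) ≡ᵇ 0)) ∧ (κ (a + v) ≡ᵇ suc c)) (<ᵇ-false (m≤m+n a v)) ⟩
        not (κ (a + v) ≡ᵇ 0) ∧ (κ (a + v) ≡ᵇ suc c)
      ≡⟨ nonzero-class (κ (a + v)) c ⟩
        κ (a + v) ≡ᵇ suc c
      ≡⟨ cong (_≡ᵇ suc c) (mod-period α v) ⟩
        v % α ≡ᵇ suc c
      ∎

fTC-split : ∀ m a q r → r < suc a → suc m ≡ suc q * suc a + r →
  fTC (suc m) (suc a) ≡ fT m (suc a) + turanIndex a q (r ∸ 1)
fTC-split m a q r r<α n≡ = begin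
    fTC (suc m) (suc a)
  ≡⟨ fTC-stableCount (suc m) a ⟩
    stableCount TC unrestricted (suc m)
  ≡⟨ stableCount-suc TC unrestricted m ⟩
    stableCount (up TC) unrestricted m + stableCount (up TC) (avoid TC unrestricted) m
  ≡⟨ cong₂ _+_ (without-hub m a) (with-hub m a q r r<α m≡) ⟩
    fT m (suc a) + turanIndex a q (r ∸ 1)
  ∎
  where
  TC : Adj
  TC = turanConnAdj a
  m≡ : m ≡ a + (q * suc a + r)
  m≡ = suc-injective (trans n≡ (cong suc (+-assoc a (q * suc a) r)))

divide : ∀ n a → suc a ≤ n → ∃₂ λ q r → r < suc a × n ≡ suc q * suc a + r
divide n a α≤n with n / suc a | m≥n⇒m/n>0 {n} {suc a} α≤n | m≡m%n+[m/n]*n n (suc a)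
... | suc q | _ | n≡ = q , n % suc a , m%n<n n (suc a) , trans n≡ (+-comm (n % suc a) (suc q * suc a))

div-exact : ∀ a q r → r < suc a → (q * suc a + r) / suc a ≡ q
div-exact a q r r<α = begin
    (q * suc a + r) / suc a            ≡⟨ +-distrib-/-∣ˡ r (n∣m*n q) ⟩
    q * suc a / suc a + r / suc a      ≡⟨ cong₂ _+_ (m*n/n≡m q (suc a)) (m<n⇒m/n≡0 r<α) ⟩
    q + 0                              ≡⟨ +-identityʳ q ⟩
    q                                  ∎

ceilDiv-exact : ∀ a k r → r < suc a → ceilDiv (k * suc a + r) (suc a) ≡ k + ind (0 <ᵇ r)
ceilDiv-exact a k zero _ = begin
    (k * suc a + 0 + a) / suc a   ≡⟨ cong (λ x → (x + a) / suc a) (+-identityʳ (k * suc a)) ⟩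
    (k * suc a + a) / suc a       ≡⟨ div-exact a k a ≤-refl ⟩
    k                             ≡⟨ +-identityʳ k ⟨
    k + 0                         ∎
ceilDiv-exact a k (suc r) (s≤s r<a) = begin
    (k * suc a + suc r + a) / suc a   ≡⟨ cong (_/ suc a) (carry k a r) ⟩
    (suc k * suc a + r) / suc a       ≡⟨ div-exact a (suc k) r (m<n⇒m<1+n r<a) ⟩
    suc k                             ≡⟨ +-comm 1 k ⟩
    k + 1                             ∎
  where
  carry : ∀ k a r → k * suc a + suc r + a ≡ suc k * suc a + r
  carry = solve-∀

reducedOrder : ℕ → ℕ → ℕ
reducedOrder n α = n ∸ ceilDiv n α ∸ α + 1

-- Truncated subtraction is exact here because K ≥ 1.
∸-∸-+1 : ∀ {n c α K} → 1 ≤ K → n + 1 ≡ c + α + K → n ∸ c ∸ α + 1 ≡ K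
∸-∸-+1 {n} {c} {α} {suc k} _ eq = begin
    n ∸ c ∸ α + 1               ≡⟨ cong (λ x → x ∸ c ∸ α + 1) n≡ ⟩
    c + α + k ∸ c ∸ α + 1       ≡⟨ cong (λ x → x ∸ c ∸ α + 1) (+-assoc c α k) ⟩
    c + (α + k) ∸ c ∸ α + 1     ≡⟨ cong (λ x → x ∸ α + 1) (m+n∸m≡n c (α + k)) ⟩
    α + k ∸ α + 1               ≡⟨ cong (_+ 1) (m+n∸m≡n α k) ⟩
    k + 1                       ≡⟨ +-comm k 1 ⟩
    suc k                       ∎
  where
  n≡ : n ≡ c + α + k
  n≡ = suc-injective (trans (+-comm 1 n) (trans eq (+-suc (c + α) k)))

reducedOrder-exact : ∀ a q r → r < suc a → 1 ≤ q * a + (r ∸ 1) →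
  reducedOrder (suc q * suc a + r) (suc a) ≡ q * a + (r ∸ 1)
reducedOrder-exact a q r r<α positive =
  ∸-∸-+1 {suc q * suc a + r} {ceilDiv (suc q * suc a + r) (suc a)} {suc a} positive (begin
    suc q * suc a + r + 1
  ≡⟨ order-identity r ⟩
    suc q + ind (0 <ᵇ r) + suc a + (q * a + (r ∸ 1))
  ≡⟨ cong (λ c → c + suc a + (q * a + (r ∸ 1))) (ceilDiv-exact a (suc q) r r<α) ⟨
    ceilDiv (suc q * suc a + r) (suc a) + suc a + (q * a + (r ∸ 1))
  ∎)
  where
  order-identity : ∀ r → suc q * suc a + r + 1 ≡ suc q + ind (0 <ᵇ r) + suc a + (q * a + (r ∸ 1))
  order-identity zero = identity₀ q a
    where
    identity₀ : ∀ q a → suc q * suc a + 0 + 1 ≡ suc q + 0 + suc a + (q * a + 0)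
    identity₀ = solve-∀
  order-identity (suc r) = identity₊ q a r
    where
    identity₊ : ∀ q a r → suc q * suc a + suc r + 1 ≡ suc q + 1 + suc a + (q * a + r)
    identity₊ = solve-∀

-- α = 1: TC_{n,1} is the complete graph K_n.
fTC-complete : ∀ m → fTC (suc m) 1 ≡ suc m + 1
fTC-complete m = begin
    fTC (suc m) 1          ≡⟨ fTC-split m 0 m 0 (s≤s z≤n) n≡ ⟩
    fT m 1 + 1             ≡⟨ cong (_+ 1) (fT-complete m) ⟩
    suc m + 1              ∎
  where
  n≡ : suc m ≡ suc m * 1 + 0
  n≡ = sym (trans (+-identityʳ (suc m * 1)) (*-identityʳ (suc m)))

-- α = n - 1: n = α + 1, so the hub's clique is an edge and every other clique a vertex.
fTC-pendant : ∀ a → fTC (suc (suc a)) (suc a) ≡ 2 ^ suc a + 1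
fTC-pendant zero = fTC-complete 1   -- n = 2, α = 1: both descriptions of K₂
fTC-pendant (suc b) = begin
    fTC (suc α) α                       ≡⟨ fTC-split α (suc b) 0 1 (s≤s (s≤s z≤n)) n≡ ⟩
    fT α α + turanIndex (suc b) 0 0     ≡⟨ cong₂ _+_ (fT-edgeless {a = suc b} ≤-refl) (turanIndex-edgeless {suc b} z≤n) ⟩
    2 ^ α + 1                           ∎
  where
  α : ℕ
  α = suc (suc b)
  n≡ : suc α ≡ 1 * α + 1
  n≡ = sym (trans (cong (_+ 1) (*-identityˡ α)) (+-comm α 1))

-- n' ≥ 1, because n ≥ α + 2.
reducedOrder-positive : ∀ {m b} q r → suc (suc b) ≤ m → suc (suc m) ≡ suc q * suc (suc b) + r →
  1 ≤ q * suc b + (r ∸ 1)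
reducedOrder-positive (suc q) r _ _ = s≤s z≤n
reducedOrder-positive {m} {b} zero r α≤m n≡ = positive (+-cancelˡ-≤ α 2 r α+2≤α+r)
  where
  α : ℕ
  α = suc (suc b)
  α+2≤α+r : α + 2 ≤ α + r
  α+2≤α+r = ≤-trans (+-monoˡ-≤ 2 α≤m)
    (≤-trans (≤-reflexive (+-comm m 2)) (≤-reflexive (trans n≡ (cong (_+ r) (*-identityˡ α)))))
  positive : 2 ≤ r → 1 ≤ 0 * suc b + (r ∸ 1)
  positive (s≤s (s≤s _)) = s≤s z≤n

-- 2 ≤ α ≤ n - 2: divide n = (q+1)α + r and recognise the second summand of the
-- hub decomposition as T_{n',α-1} = T_{n',α'}.
fTC-general : ∀ m b → suc (suc b) ≤ m → fTC (suc (suc m)) (suc (suc b)) ≡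
  fT (suc m) (suc (suc b)) + fT (reducedOrder (suc (suc m)) (suc (suc b))) (reducedOrder (suc (suc m)) (suc (suc b)) ⊓ suc b)
fTC-general m b α≤m with divide (suc (suc m)) (suc b) (≤-trans α≤m (≤-trans (n≤1+n m) (n≤1+n (suc m))))
... | q , r , r<α , n≡ = begin
    fTC (suc (suc m)) α
  ≡⟨ fTC-split (suc m) (suc b) q r r<α n≡ ⟩
    fT (suc m) α + turanIndex (suc b) q (r ∸ 1)
  ≡⟨ cong (fT (suc m) α +_) (fT-turanIndex b q (r ∸ 1) (≤-trans (m∸n≤m r 1) (≤-pred r<α))) ⟨
    fT (suc m) α + fT n′ (suc b)
  ≡⟨ cong (fT (suc m) α +_) (fT-min n′ b positive) ⟩
    fT (suc m) α + fT n′ (n′ ⊓ suc b)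
  ≡⟨ cong (λ k → fT (suc m) α + fT k (k ⊓ suc b)) order ⟨
    fT (suc m) α + fT (reducedOrder (suc (suc m)) α) (reducedOrder (suc (suc m)) α ⊓ suc b)
  ∎
  where
  α : ℕ
  α = suc (suc b)
  n′ : ℕ
  n′ = q * suc b + (r ∸ 1)
  positive : 1 ≤ n′
  positive = reducedOrder-positive q r α≤m n≡
  order : reducedOrder (suc (suc m)) α ≡ n′
  order = trans (cong (λ n → reducedOrder n α) n≡) (reducedOrder-exact (suc b) q r r<α positive)

lemma14 : (n α : ℕ) → 1 ≤ α → α ≤ n ∸ 1 →
    (α ≡ 1 → fTC n α ≡ n + 1) ×
    (α ≡ n ∸ 1 → fTC n α ≡ 2 ^ (n ∸ 1) + 1) ×
    (2 ≤ α → α ≤ n ∸ 2 →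
      fTC n α ≡ fT (n ∸ 1) α
        + fT (n ∸ ceilDiv n α ∸ α + 1) ((n ∸ ceilDiv n α ∸ α + 1) ⊓ (α ∸ 1)))
lemma14 _ zero () _
lemma14 zero (suc a) _ ()
lemma14 (suc zero) (suc a) _ ()
lemma14 (suc (suc m)) (suc a) _ _ = case-α≡1 , case-α≡n-1 , case-2≤α≤n-2
  where
  case-α≡1 : suc a ≡ 1 → fTC (suc (suc m)) (suc a) ≡ suc (suc m) + 1
  case-α≡1 refl = fTC-complete (suc m)
  case-α≡n-1 : suc a ≡ suc m → fTC (suc (suc m)) (suc a) ≡ 2 ^ suc m + 1
  case-α≡n-1 refl = fTC-pendant a
  case-2≤α≤n-2 : 2 ≤ suc a → suc a ≤ m → fTC (suc (suc m)) (suc a) ≡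
    fT (suc m) (suc a) + fT (reducedOrder (suc (suc m)) (suc a)) (reducedOrder (suc (suc m)) (suc a) ⊓ a)
  case-2≤α≤n-2 (s≤s (s≤s {n = b} _)) α≤m = fTC-general m b α≤m
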